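{- Let $G$ be a group given by a monoid presentation $\mathrm{mon}\langle X_G, R_G\rangle$ with natural homomorphism $\theta:X_G^*\to G$, and let $X_H,X_K\subseteq X_G^*$ with $\theta(X_H)$ generating a subgroup $H$ and $\theta(X_K)$ generating a subgroup $K$. With new symbols $H,K$, let $T_+ = (\{H,K\}\cup X_G)^*$, $T=\{HwK: w\in X_G^*\}$ and $R = R_G \cup \{(Hh, H) : h \in X_H\} \cup \{(kK, K) : k \in X_K\}$. Let $R^C$ be a finite, complete rewriting system on $T_+$ generating the same congruence as $R$ (a finite complete double coset rewriting system for $H\backslash G/K$). Then there is a regular expression representing a regular language $L$ over the alphabet $X_G\cup\{H,K\}$ with $L\subseteq T$ which is a set of normal forms for the double cosets: the map $HwK\mapsto H\theta(w)K$ is a bijection from $L$ onto $H\backslash G/K=\{[g]_\sim : g\in G\}$.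
   Context: Double cosets: $g\sim g'$ iff $hgk=g'$ for some $h\in H,k\in K$, with classes $[g]_\sim$. A rewriting system $R^C$ on $T_+$ generates $\to_{R^C}$ via $ulv\to urv$ for $(l,r)\in R^C$; complete means terminating and confluent. -}

module Defs where

open import Data.Nat using (ℕ)
open import Data.Fin using (Fin)
open import Data.List using (List; []; _∷_; _++_; map; [_])
open import Data.List.Membership.Propositional using (_∈_)
open import Data.Product using (Σ; ∃; _×_; _,_)
open import Data.Sum using (_⊎_)
open import Relation.Binary.PropositionalEquality using (_≡_)
open import Relation.Binary.Construct.Closure.ReflexiveTransitive using (Star)
open import Relation.Binary.Construct.Closure.Equivalence using (EqClosure)
open import Induction.WellFounded using (WellFounded)
open import Function using (flip)

Word : Set → Set
Word A = List A

Rules : Set → Set₁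
Rules A = Word A → Word A → Set

data Step {A : Set} (R : Rules A) : Word A → Word A → Set where
  step : ∀ u l r v → R l r → Step R (u ++ l ++ v) (u ++ r ++ v)

Cong : {A : Set} → Rules A → Word A → Word A → Set
Cong R = EqClosure (Step R)

ListRules : {A : Set} → List (Word A × Word A) → Rules A
ListRules RC l r = (l , r) ∈ RC

_⟶*[_]_ : {A : Set} → Word A → Rules A → Word A → Set
u ⟶*[ R ] v = Star (Step R) u v

Terminating : {A : Set} → Rules A → Set
Terminating R = WellFounded (flip (Step R))

Confluent : {A : Set} → Rules A → Set
Confluent R = ∀ a b c → a ⟶*[ R ] b → a ⟶*[ R ] c →
  ∃ λ d → (b ⟶*[ R ] d) × (c ⟶*[ R ] d)

Complete : {A : Set} → Rules A → Set
Complete R = Terminating R × Confluent R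

data RegExp (A : Set) : Set where
  ∅ᴿ   : RegExp A
  εᴿ   : RegExp A
  symᴿ : A → RegExp A
  _∣ᴿ_ : RegExp A → RegExp A → RegExp A
  _∙ᴿ_ : RegExp A → RegExp A → RegExp A
  _⋆ᴿ  : RegExp A → RegExp A

data _∈L_ {A : Set} : Word A → RegExp A → Set where
  in-ε   : [] ∈L εᴿ
  in-sym : ∀ a → [ a ] ∈L symᴿ a
  in-∣ˡ  : ∀ {w e f} → w ∈L e → w ∈L (e ∣ᴿ f)
  in-∣ʳ  : ∀ {w e f} → w ∈L f → w ∈L (e ∣ᴿ f)
  in-∙   : ∀ {u v e f} → u ∈L e → v ∈L f → (u ++ v) ∈L (e ∙ᴿ f)
  in-⋆0  : ∀ {e} → [] ∈L (e ⋆ᴿ)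
  in-⋆s  : ∀ {u v e} → u ∈L e → v ∈L (e ⋆ᴿ) → (u ++ v) ∈L (e ⋆ᴿ)

-- The group G = mon⟨X_G , R_G⟩ with X_G = Fin n; θ(w) is the class of w
-- under  Cong RG.  Elements of G are represented by words.

module Presentation {n : ℕ} (RG : Rules (Fin n)) where

  X* : Set
  X* = Word (Fin n)

  _≈G_ : X* → X* → Set
  _≈G_ = Cong RG

  IsGroup : Set
  IsGroup = ∀ w → ∃ λ v → ((w ++ v) ≈G []) × ((v ++ w) ≈G [])

  -- words representing elements of the subgroup generated by θ(X)
  data InSubgroup (X : X* → Set) : X* → Set where
    sg-ε   : InSubgroup X []
    sg-gen : ∀ {u x} → InSubgroup X u → X x → InSubgroup X (u ++ x)
    sg-inv : ∀ {u x v} → InSubgroup X u → X x → (x ++ v) ≈G []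
             → InSubgroup X (u ++ v)

  DoubleCoset : (XH XK : X* → Set) → X* → X* → Set
  DoubleCoset XH XK w w' = ∃ λ h → ∃ λ k →
    InSubgroup XH h × InSubgroup XK k × ((h ++ w ++ k) ≈G w')

data Sym (n : ℕ) : Set where
  gen : Fin n → Sym n
  Hₛ  : Sym n
  Kₛ  : Sym n

HwK : {n : ℕ} → Word (Fin n) → Word (Sym n)
HwK w = Hₛ ∷ map gen w ++ [ Kₛ ]

DCRules : {n : ℕ} → Rules (Fin n) → (Word (Fin n) → Set) → (Word (Fin n) → Set)
        → Rules (Sym n)
DCRules RG XH XK u v =
    (∃ λ l → ∃ λ r → RG l r × (u ≡ map gen l) × (v ≡ map gen r))
  ⊎ (∃ λ h → XH h × (u ≡ Hₛ ∷ map gen h) × (v ≡ [ Hₛ ]))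
  ⊎ (∃ λ k → XK k × (u ≡ map gen k ++ [ Kₛ ]) × (v ≡ [ Kₛ ]))

module Submission where

-- Every word congruent to H g K has the shape a H b K c with θ(a) = θ(c) = 1 and θ(b) ∼ g,
-- because each rule of R, applied in either direction, preserves this shape. In a normal form
-- the factors a and c are irreducible and congruent to the empty word, hence empty, so the
-- normal form of H g K is an irreducible word H w K with w ∼ g; by confluence distinct such
-- words lie in distinct double cosets. The irreducible words H w K form a regular language:
-- an automaton reading H w K that remembers the next maxLhs letters of its input detects every
-- left-hand side, and Kleene's construction turns it into a regular expression.

open import Defs
open import Data.Empty using (⊥; ⊥-elim)
open import Data.Fin using (Fin)
open import Data.Fin.Properties using () renaming (_≟_ to _≟ᶠ_)
open import Data.List using (List; []; _∷_; _++_; [_]; map; take; drop; length; allFin; cartesianProductWith)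
open import Data.List.Extrema.Nat using (max; xs≤max)
open import Data.List.Membership.Propositional using (_∈_; _∉_; find; lose)
open import Data.List.Membership.Propositional.Properties
  using (∈-map⁺; ∈-++⁺ʳ; ∈-++⁻; ∈-allFin; ∈-cartesianProductWith⁺)
open import Data.List.Properties
  using (++-assoc; ++-identityʳ; ++-conicalˡ; ++-conicalʳ; ++-monoid; map-++; map-injective;
         ∷-injectiveˡ; ∷-injectiveʳ; ++-cancelʳ; take-all; take++drop≡id; length-take; take-take; ≡-dec)
open import Data.List.Relation.Binary.Infix.Heterogeneous using (Infix; MkView; toView; _++ⁱ_)
import Data.List.Relation.Binary.Infix.Heterogeneous as Infix
open import Data.List.Relation.Binary.Infix.Heterogeneous.Properties using (infix?; ∷⁻)
open import Data.List.Relation.Binary.Pointwise using (Pointwise-≡⇒≡)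
import Data.List.Relation.Binary.Pointwise as Pointwise
open import Data.List.Relation.Binary.Prefix.Heterogeneous using (Prefix; []; _++ᵖ_)
import Data.List.Relation.Binary.Prefix.Heterogeneous.Properties as Prefix
open import Data.List.Relation.Unary.Any using (Any; here; there; any?)
import Data.List.Relation.Unary.Any as Any
import Data.List.Relation.Unary.All as All
open import Data.Nat using (ℕ; zero; suc; _≤_; s≤s)
open import Data.Nat.Properties using (≤-trans; ≤-reflexive; n≤1+n; m⊓n≤m; m≤n⇒m⊓n≡m)
open import Data.Product using (∃; ∃₂; _×_; _,_; proj₁; proj₂)
open import Data.Sum using (_⊎_; inj₁; inj₂)
open import Function using (_∘_; flip; case_of_; _⇔_; mk⇔; Equivalence)
open import Induction.WellFounded using (Acc; acc)
open import Relation.Binary.Definitions using (DecidableEquality)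
open import Relation.Binary.PropositionalEquality
  using (_≡_; refl; sym; trans; cong; subst; subst₂; module ≡-Reasoning)
open import Relation.Binary.Construct.Closure.ReflexiveTransitive using (ε; _◅_; _◅◅_)
open import Relation.Binary.Construct.Closure.Symmetric using (fwd; bwd)
import Relation.Binary.Construct.Closure.Equivalence as EqClosure
import Relation.Binary.Reasoning.Setoid as SetoidReasoning
open import Relation.Nullary using (Dec; yes; no; ¬_)
import Relation.Nullary.Decidable as Dec
open import Tactic.MonoidSolver using (solve)

Irreducible : {A : Set} → Rules A → Word A → Set
Irreducible R x = ∀ y → ¬ Step R x y

module _ {A : Set} {R : Rules A} where

  step-context : ∀ p q {x y} → Step R x y → Step R (p ++ x ++ q) (p ++ y ++ q)
  step-context p q (step u l r v lr) =
    subst₂ (Step R) (reassociate l) (reassociate r) (step (p ++ u) l r (v ++ q) lr)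
    where
      reassociate : ∀ m → (p ++ u) ++ m ++ v ++ q ≡ p ++ (u ++ m ++ v) ++ q
      reassociate m = solve (++-monoid A)

  cong-context : ∀ p q {x y} → Cong R x y → Cong R (p ++ x ++ q) (p ++ y ++ q)
  cong-context p q = EqClosure.gmap (λ x → p ++ x ++ q) (step-context p q)

  reduction⇒cong : ∀ {x y} → x ⟶*[ R ] y → Cong R x y
  reduction⇒cong ε = ε
  reduction⇒cong (s ◅ ss) = fwd s ◅ reduction⇒cong ss

  irreducible-++⁻ˡ : ∀ p q → Irreducible R (p ++ q) → Irreducible R p
  irreducible-++⁻ˡ p q irr y s = irr (y ++ q) (step-context [] q s)

  irreducible-++⁻ʳ : ∀ p q → Irreducible R (p ++ q) → Irreducible R q
  irreducible-++⁻ʳ p q irr y s =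
    irr (p ++ y) (subst₂ (Step R) (cong (p ++_) (++-identityʳ q)) (cong (p ++_) (++-identityʳ y))
                         (step-context p [] s))

  irreducible-⟶*-≡ : ∀ {x y} → Irreducible R x → x ⟶*[ R ] y → x ≡ y
  irreducible-⟶*-≡ irr ε = refl
  irreducible-⟶*-≡ irr (s ◅ _) = ⊥-elim (irr _ s)

  empty-lhs⇒¬terminating : ∀ {r} → R [] r → ¬ Terminating R
  empty-lhs⇒¬terminating {r} lr wf = diverge [] (wf [])
    where
      diverge : ∀ x → ¬ Acc (flip (Step R)) x
      diverge x (acc rs) =
        diverge (x ++ r ++ [])
                (rs (subst (λ z → Step R z (x ++ r ++ [])) (++-identityʳ x) (step x [] r [] lr)))

  terminating⇒irreducible-[] : Terminating R → Irreducible R []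
  terminating⇒irreducible-[] wf y s = stuck s refl
    where
      stuck : ∀ {x y} → Step R x y → x ≡ [] → ⊥
      stuck (step u l r v lr) e =
        empty-lhs⇒¬terminating (subst (λ l → R l r) (++-conicalˡ l v (++-conicalʳ u _ e)) lr) wf

  module _ (confluent : Confluent R) where

    cong⇒joinable : ∀ {x y} → Cong R x y → ∃ λ d → (x ⟶*[ R ] d) × (y ⟶*[ R ] d)
    cong⇒joinable ε = _ , ε , ε
    cong⇒joinable (fwd s ◅ c) with d , p , q ← cong⇒joinable c = d , s ◅ p , q
    cong⇒joinable (bwd s ◅ c) with d , p , q ← cong⇒joinable c
      with e , p′ , q′ ← confluent _ _ _ (s ◅ ε) p = e , p′ , q ◅◅ q′

    irreducible-cong⇒≡ : ∀ {x y} → Irreducible R x → Irreducible R y → Cong R x y → x ≡ y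
    irreducible-cong⇒≡ irrx irry c with _ , p , q ← cong⇒joinable c =
      trans (irreducible-⟶*-≡ irrx p) (sym (irreducible-⟶*-≡ irry q))

module ListRewriting {A : Set} (_≟_ : DecidableEquality A) (RC : List (Word A × Word A)) where

  prefix-++ : ∀ (l v : Word A) → Prefix _≡_ l (l ++ v)
  prefix-++ l v = Prefix.fromPointwise (Pointwise.refl refl) ++ᵖ v

  LhsInfix : Word A → Set
  LhsInfix x = Any (λ rule → Infix _≡_ (proj₁ rule) x) RC

  LhsPrefix : Word A → Set
  LhsPrefix x = Any (λ rule → Prefix _≡_ (proj₁ rule) x) RC

  lhsPrefix? : ∀ x → Dec (LhsPrefix x)
  lhsPrefix? x = any? (λ rule → Prefix.prefix? _≟_ (proj₁ rule) x) RC

  step⇒lhsInfix : ∀ {x y} → Step (ListRules RC) x y → LhsInfix x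
  step⇒lhsInfix (step u l r v lr) = lose lr (u ++ⁱ Infix.here (prefix-++ l v))

  lhsInfix⇒step : ∀ {x} → LhsInfix x → ∃ (Step (ListRules RC) x)
  lhsInfix⇒step i with (l , r) , lr , inf ← find i with toView inf
  ... | MkView u l≗m v =
    u ++ r ++ v ,
    subst (λ m → Step (ListRules RC) (u ++ m ++ v) (u ++ r ++ v)) (Pointwise-≡⇒≡ l≗m) (step u l r v lr)

  step? : ∀ x → Dec (∃ (Step (ListRules RC) x))
  step? x = Dec.map′ lhsInfix⇒step (step⇒lhsInfix ∘ proj₂) (any? (λ rule → infix? _≟_ (proj₁ rule) x) RC)

  normalForm : Terminating (ListRules RC) →
               ∀ x → ∃ λ v → (x ⟶*[ ListRules RC ] v) × Irreducible (ListRules RC) v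
  normalForm wf x = reduce x (wf x)
    where
      reduce : ∀ x → Acc (flip (Step (ListRules RC))) x →
               ∃ λ v → (x ⟶*[ ListRules RC ] v) × Irreducible (ListRules RC) v
      reduce x (acc rs) with step? x
      ... | no irr = x , ε , λ y s → irr (y , s)
      ... | yes (y , s) with v , ss , irr ← reduce y (rs s) = v , s ◅ ss , irr

  irreducible⇒¬lhsPrefix : ∀ {x} → Irreducible (ListRules RC) x → ¬ LhsPrefix x
  irreducible⇒¬lhsPrefix irr p with y , s ← lhsInfix⇒step (Any.map Infix.here p) = irr y s

  ¬lhsPrefix⇒irreducible-[] : ∀ {x} → ¬ LhsPrefix x → Irreducible (ListRules RC) []
  ¬lhsPrefix⇒irreducible-[] ¬p y s = ¬p (Any.map (λ { (Infix.here []) → [] }) (step⇒lhsInfix s))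

  irreducible-∷ : ∀ {a y} → ¬ LhsPrefix (a ∷ y) →
                  Irreducible (ListRules RC) y → Irreducible (ListRules RC) (a ∷ y)
  irreducible-∷ ¬p irr z s with rule , lr , inf ← find (step⇒lhsInfix s) with ∷⁻ inf
  ... | inj₁ pre = ¬p (lose lr pre)
  ... | inj₂ inf′ = irr _ (proj₂ (lhsInfix⇒step (lose lr inf′)))

  maxLhs : ℕ
  maxLhs = max 0 (map (length ∘ proj₁) RC)

  lhs-length≤maxLhs : ∀ {l r} → (l , r) ∈ RC → length l ≤ maxLhs
  lhs-length≤maxLhs lr = All.lookup (xs≤max 0 (map (length ∘ proj₁) RC)) (∈-map⁺ (length ∘ proj₁) lr)

  lhsPrefix⇔lhsPrefix-take : ∀ {k} → maxLhs ≤ k → ∀ y → LhsPrefix y ⇔ LhsPrefix (take k y)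
  lhsPrefix⇔lhsPrefix-take {k} maxLhs≤k y = mk⇔ to (Any.map (λ pre → Prefix.trans trans pre take-prefix))
    where
      take-prefix : Prefix _≡_ (take k y) y
      take-prefix = subst (Prefix _≡_ (take k y)) (take++drop≡id k y) (prefix-++ (take k y) (drop k y))

      to : LhsPrefix y → LhsPrefix (take k y)
      to p with (l , r) , lr , pre ← find p =
        lose lr (subst (λ m → Prefix _≡_ m (take k y))
                       (take-all k l (≤-trans (lhs-length≤maxLhs lr) maxLhs≤k)) (Prefix.take⁺ k pre))

module Kleene {A S : Set} (_≟_ : DecidableEquality S)
              (alphabet : List A) (∈-alphabet : ∀ a → a ∈ alphabet)
              (Δ : S → A → S → Set) (Δ? : ∀ i a j → Dec (Δ i a j)) where

  -- Every state visited strictly between the two endpoints lies in ks.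
  data Path (ks : List S) : S → Word A → S → Set where
    []   : ∀ {i} → Path ks i [] i
    edge : ∀ {i a k w j} → Δ i a k → k ∈ ks ⊎ w ≡ [] → Path ks k w j → Path ks i (a ∷ w) j

  path-weaken : ∀ {k ks i w j} → Path ks i w j → Path (k ∷ ks) i w j
  path-weaken [] = []
  path-weaken (edge t (inj₁ k∈ks) p) = edge t (inj₁ (there k∈ks)) (path-weaken p)
  path-weaken (edge t (inj₂ w≡[]) p) = edge t (inj₂ w≡[]) (path-weaken p)

  path-++ : ∀ {ks i u k v j} → Path ks i u k → k ∈ ks → Path ks k v j → Path ks i (u ++ v) j
  path-++ [] k∈ks q = q
  path-++ (edge t (inj₁ m) p) k∈ks q = edge t (inj₁ m) (path-++ p k∈ks q)
  path-++ (edge t (inj₂ refl) []) k∈ks q = edge t (inj₁ k∈ks) q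

  ε-if-≡ : S → S → RegExp A
  ε-if-≡ i j with i ≟ j
  ... | yes _ = εᴿ
  ... | no _ = ∅ᴿ

  letters : S → S → List A → RegExp A
  letters i j [] = ∅ᴿ
  letters i j (a ∷ as) with Δ? i a j
  ... | yes _ = symᴿ a ∣ᴿ letters i j as
  ... | no _ = letters i j as

  pathRegExp : List S → S → S → RegExp A
  pathRegExp [] i j = ε-if-≡ i j ∣ᴿ letters i j alphabet
  pathRegExp (k ∷ ks) i j =
    pathRegExp ks i j ∣ᴿ (pathRegExp ks i k ∙ᴿ ((pathRegExp ks k k ⋆ᴿ) ∙ᴿ pathRegExp ks k j))

  ε-if-≡-sound : ∀ {ks i j w} → w ∈L ε-if-≡ i j → Path ks i w j
  ε-if-≡-sound {i = i} {j} m with i ≟ j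
  ε-if-≡-sound in-ε | yes refl = []
  ε-if-≡-sound () | no _

  ε-if-≡-complete : ∀ i → [] ∈L ε-if-≡ i i
  ε-if-≡-complete i with i ≟ i
  ... | yes _ = in-ε
  ... | no i≢i = ⊥-elim (i≢i refl)

  letters-sound : ∀ {ks i j w} as → w ∈L letters i j as → Path ks i w j
  letters-sound {i = i} {j} (a ∷ as) m with Δ? i a j
  letters-sound (a ∷ as) (in-∣ˡ (in-sym .a)) | yes t = edge t (inj₂ refl) []
  letters-sound (a ∷ as) (in-∣ʳ m) | yes _ = letters-sound as m
  letters-sound (a ∷ as) m | no _ = letters-sound as m

  letters-complete : ∀ {i j a} as → Δ i a j → a ∈ as → [ a ] ∈L letters i j as
  letters-complete {i} {j} (b ∷ as) t a∈ with Δ? i b j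
  letters-complete (b ∷ as) t (here refl) | yes _ = in-∣ˡ (in-sym b)
  letters-complete (b ∷ as) t (there a∈) | yes _ = in-∣ʳ (letters-complete as t a∈)
  letters-complete (b ∷ as) t (here refl) | no ¬t = ⊥-elim (¬t t)
  letters-complete (b ∷ as) t (there a∈) | no _ = letters-complete as t a∈

  pathRegExp-sound : ∀ ks {i j w} → w ∈L pathRegExp ks i j → Path ks i w j
  pathRegExp-sound [] (in-∣ˡ m) = ε-if-≡-sound m
  pathRegExp-sound [] (in-∣ʳ m) = letters-sound alphabet m
  pathRegExp-sound (k ∷ ks) (in-∣ˡ m) = path-weaken (pathRegExp-sound ks m)
  pathRegExp-sound (k ∷ ks) (in-∣ʳ (in-∙ m (in-∙ loops m′))) =
    path-++ (path-weaken (pathRegExp-sound ks m)) (here refl)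
            (path-++ (loops-sound loops) (here refl) (path-weaken (pathRegExp-sound ks m′)))
    where
      loops-sound : ∀ {w} → w ∈L (pathRegExp ks k k ⋆ᴿ) → Path (k ∷ ks) k w k
      loops-sound in-⋆0 = []
      loops-sound (in-⋆s m ms) = path-++ (path-weaken (pathRegExp-sound ks m)) (here refl) (loops-sound ms)

  ThroughState : List S → S → S → S → Word A → Set
  ThroughState ks k i j w = ∃₂ λ u v → ∃ λ z → w ≡ u ++ v ++ z
    × u ∈L pathRegExp ks i k × v ∈L (pathRegExp ks k k ⋆ᴿ) × z ∈L pathRegExp ks k j

  split-at-state : ∀ ks k → (∀ {i j w} → Path ks i w j → w ∈L pathRegExp ks i j) →
                   ∀ {i w j} → Path (k ∷ ks) i w j → Path ks i w j ⊎ ThroughState ks k i j w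
  split-at-state ks k complete [] = inj₁ []
  split-at-state ks k complete (edge t (inj₂ refl) []) = inj₁ (edge t (inj₂ refl) [])
  split-at-state ks k complete (edge {a = a} t (inj₁ (here refl)) p) with split-at-state ks k complete p
  ... | inj₁ p′ = inj₂ ([ a ] , [] , _ , refl , complete (edge t (inj₂ refl) []) , in-⋆0 , complete p′)
  ... | inj₂ (u , v , z , refl , mu , mv , mz) =
    inj₂ ([ a ] , u ++ v , z , cong (a ∷_) (sym (++-assoc u v z)) ,
          complete (edge t (inj₂ refl) []) , in-⋆s mu mv , mz)
  split-at-state ks k complete (edge {a = a} t (inj₁ (there m)) p) with split-at-state ks k complete p
  ... | inj₁ p′ = inj₁ (edge t (inj₁ m) p′)
  ... | inj₂ (u , v , z , refl , mu , mv , mz) =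
    inj₂ (a ∷ u , v , z , refl , complete (edge t (inj₁ m) (pathRegExp-sound ks mu)) , mv , mz)

  pathRegExp-complete : ∀ ks {i j w} → Path ks i w j → w ∈L pathRegExp ks i j
  pathRegExp-complete [] {i} [] = in-∣ˡ (ε-if-≡-complete i)
  pathRegExp-complete [] (edge t (inj₂ refl) []) = in-∣ʳ (letters-complete alphabet t (∈-alphabet _))
  pathRegExp-complete (k ∷ ks) p with split-at-state ks k (pathRegExp-complete ks) p
  ... | inj₁ p′ = in-∣ˡ (pathRegExp-complete ks p′)
  ... | inj₂ (u , v , z , refl , mu , mv , mz) = in-∣ʳ (in-∙ mu (in-∙ mv mz))

module _ {A : Set} where

  prefix-split : ∀ {s : A} m {v p t} → s ∉ m → m ++ v ≡ p ++ s ∷ t → ∃ λ q → p ≡ m ++ q × v ≡ q ++ s ∷ t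
  prefix-split [] {p = p} _ e = p , refl , e
  prefix-split (y ∷ m) {p = []} s∉m e = ⊥-elim (s∉m (here (sym (∷-injectiveˡ e))))
  prefix-split (y ∷ m) {p = z ∷ p} s∉m e with refl ← ∷-injectiveˡ e
    with q , refl , e′ ← prefix-split m (s∉m ∘ there) (∷-injectiveʳ e) = q , refl , e′

  factor-split : ∀ {s : A} m u {v p t} → s ∉ m → u ++ m ++ v ≡ p ++ s ∷ t →
                 (∃ λ q → p ≡ u ++ m ++ q × v ≡ q ++ s ∷ t) ⊎ (∃ λ q → u ≡ p ++ s ∷ q × t ≡ q ++ m ++ v)
  factor-split m [] s∉m e = inj₁ (prefix-split m s∉m e)
  factor-split m (y ∷ u) {p = []} s∉m e with refl ← ∷-injectiveˡ e = inj₂ (u , refl , sym (∷-injectiveʳ e))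
  factor-split m (y ∷ u) {p = z ∷ p} s∉m e with refl ← ∷-injectiveˡ e
    with factor-split m u s∉m (∷-injectiveʳ e)
  ... | inj₁ (q , refl , e′) = inj₁ (q , refl , e′)
  ... | inj₂ (q , refl , e′) = inj₂ (q , refl , e′)

  suffix-split : ∀ {s : A} m u {p t} → s ∉ m → u ++ m ≡ p ++ s ∷ t → ∃ λ q → u ≡ p ++ s ∷ q × t ≡ q ++ m
  suffix-split m u s∉m e with factor-split m u s∉m (trans (cong (u ++_) (++-identityʳ m)) e)
  ... | inj₁ (q , _ , e′) = ⊥-elim (case ++-conicalʳ q _ (sym e′) of λ ())
  ... | inj₂ (q , refl , e′) = q , refl , trans e′ (cong (q ++_) (++-identityʳ m))

  ∷-split-unique : ∀ {s : A} u p {x t} → s ∉ p → s ∉ t → u ++ s ∷ x ≡ p ++ s ∷ t → u ≡ p × x ≡ t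
  ∷-split-unique [] [] _ _ e = refl , ∷-injectiveʳ e
  ∷-split-unique [] (y ∷ p) s∉p _ e = ⊥-elim (s∉p (here (∷-injectiveˡ e)))
  ∷-split-unique (y ∷ u) [] _ s∉t e = ⊥-elim (s∉t (subst (_ ∈_) (∷-injectiveʳ e) (∈-++⁺ʳ u (here refl))))
  ∷-split-unique (y ∷ u) (z ∷ p) s∉p s∉t e with refl ← ∷-injectiveˡ e
    with refl , e′ ← ∷-split-unique u p (s∉p ∘ there) s∉t (∷-injectiveʳ e) = refl , e′

  map-++⁻ : ∀ {B : Set} (f : A → B) c {p q} → map f c ≡ p ++ q →
            ∃₂ λ c₁ c₂ → c ≡ c₁ ++ c₂ × p ≡ map f c₁ × q ≡ map f c₂
  map-++⁻ f c {[]} e = [] , c , refl , refl , sym e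
  map-++⁻ f (x ∷ c) {y ∷ p} e with refl ← ∷-injectiveˡ e
    with c₁ , c₂ , refl , refl , refl ← map-++⁻ f c {p} (∷-injectiveʳ e) = x ∷ c₁ , c₂ , refl , refl , refl

⌜_⌝ : ∀ {n} → Word (Fin n) → Word (Sym n)
⌜_⌝ = map gen

_≟ˢ_ : ∀ {n} → DecidableEquality (Sym n)
gen x ≟ˢ gen y = Dec.map′ (cong gen) (λ { refl → refl }) (x ≟ᶠ y)
gen _ ≟ˢ Hₛ = no λ ()
gen _ ≟ˢ Kₛ = no λ ()
Hₛ ≟ˢ gen _ = no λ ()
Hₛ ≟ˢ Hₛ = yes refl
Hₛ ≟ˢ Kₛ = no λ ()
Kₛ ≟ˢ gen _ = no λ ()
Kₛ ≟ˢ Hₛ = no λ ()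
Kₛ ≟ˢ Kₛ = yes refl

module _ {n : ℕ} where

  ⌜⌝-injective : ∀ {a b : Word (Fin n)} → ⌜ a ⌝ ≡ ⌜ b ⌝ → a ≡ b
  ⌜⌝-injective = map-injective λ { refl → refl }

  ⌜⌝-++-assoc : ∀ (a b : Word (Fin n)) t → ⌜ a ++ b ⌝ ++ t ≡ ⌜ a ⌝ ++ ⌜ b ⌝ ++ t
  ⌜⌝-++-assoc a b t = trans (cong (_++ t) (map-++ gen a b)) (++-assoc ⌜ a ⌝ ⌜ b ⌝ t)

  ⌜⌝-++₃ : ∀ (a b c : Word (Fin n)) → ⌜ a ++ b ++ c ⌝ ≡ ⌜ a ⌝ ++ ⌜ b ⌝ ++ ⌜ c ⌝
  ⌜⌝-++₃ a b c = trans (map-++ gen a (b ++ c)) (cong (⌜ a ⌝ ++_) (map-++ gen b c))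

  ⌜⌝-++₃-++ : ∀ (a b c : Word (Fin n)) t → ⌜ a ++ b ++ c ⌝ ++ t ≡ ⌜ a ⌝ ++ ⌜ b ⌝ ++ ⌜ c ⌝ ++ t
  ⌜⌝-++₃-++ a b c t = trans (⌜⌝-++-assoc a (b ++ c) t) (cong (⌜ a ⌝ ++_) (⌜⌝-++-assoc b c t))

  ⌜⌝-prefix : ∀ b {p : Word (Fin n)} {q} → ⌜ b ⌝ ≡ ⌜ p ⌝ ++ q → ∃ λ b′ → b ≡ p ++ b′ × q ≡ ⌜ b′ ⌝
  ⌜⌝-prefix b {p} {q} e with b₁ , b₂ , refl , e₁ , refl ← map-++⁻ gen b {⌜ p ⌝} {q} e
    with refl ← ⌜⌝-injective e₁ = b₂ , refl , refl

  ⌜⌝-suffix : ∀ b {p : Word (Fin n)} {q} → ⌜ b ⌝ ≡ q ++ ⌜ p ⌝ → ∃ λ b′ → b ≡ b′ ++ p × q ≡ ⌜ b′ ⌝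
  ⌜⌝-suffix b {p} {q} e with b₁ , b₂ , refl , refl , e₂ ← map-++⁻ gen b {q} {⌜ p ⌝} e
    with refl ← ⌜⌝-injective e₂ = b₁ , refl , refl

  ⌜⌝-factor : ∀ a (l : Word (Fin n)) {u q} → ⌜ a ⌝ ≡ u ++ ⌜ l ⌝ ++ q →
              ∃₂ λ a₁ a₂ → a ≡ a₁ ++ l ++ a₂ × u ≡ ⌜ a₁ ⌝ × q ≡ ⌜ a₂ ⌝
  ⌜⌝-factor a l {u} {q} e with a₁ , a′ , refl , refl , e′ ← map-++⁻ gen a {u} {⌜ l ⌝ ++ q} e
    with a₂ , refl , refl ← ⌜⌝-prefix a′ {l} (sym e′) = a₁ , a₂ , refl , refl , refl

  H∉⌜⌝ : ∀ (a : Word (Fin n)) → Hₛ ∉ ⌜ a ⌝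
  H∉⌜⌝ (_ ∷ _) (here ())
  H∉⌜⌝ (_ ∷ a) (there m) = H∉⌜⌝ a m

  K∉⌜⌝ : ∀ (a : Word (Fin n)) → Kₛ ∉ ⌜ a ⌝
  K∉⌜⌝ (_ ∷ _) (here ())
  K∉⌜⌝ (_ ∷ a) (there m) = K∉⌜⌝ a m

  H∉⌜⌝K⌜⌝ : ∀ (b c : Word (Fin n)) → Hₛ ∉ ⌜ b ⌝ ++ Kₛ ∷ ⌜ c ⌝
  H∉⌜⌝K⌜⌝ b c m with ∈-++⁻ ⌜ b ⌝ m
  ... | inj₁ m′ = H∉⌜⌝ b m′
  ... | inj₂ (there m′) = H∉⌜⌝ c m′

  K∉⌜⌝H⌜⌝ : ∀ (a b : Word (Fin n)) → Kₛ ∉ ⌜ a ⌝ ++ Hₛ ∷ ⌜ b ⌝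
  K∉⌜⌝H⌜⌝ a b m with ∈-++⁻ ⌜ a ⌝ m
  ... | inj₁ m′ = K∉⌜⌝ a m′
  ... | inj₂ (there m′) = K∉⌜⌝ b m′

  HwK-injective : ∀ {w w′ : Word (Fin n)} → HwK w ≡ HwK w′ → w ≡ w′
  HwK-injective e = ⌜⌝-injective (++-cancelʳ [ Kₛ ] _ _ (∷-injectiveʳ e))

  HwK-++ : ∀ (w : Word (Fin n)) t → Hₛ ∷ ⌜ w ⌝ ++ Kₛ ∷ t ≡ HwK w ++ t
  HwK-++ w t = cong (Hₛ ∷_) (sym (++-assoc ⌜ w ⌝ [ Kₛ ] t))

module NormalFormAutomaton {n : ℕ} (RC : List (Word (Sym n) × Word (Sym n))) where

  open ListRewriting _≟ˢ_ RC

  data State : Set where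
    initial final : State
    window : Word (Sym n) → State

  _≟State_ : DecidableEquality State
  initial ≟State initial = yes refl
  initial ≟State final = no λ ()
  initial ≟State window _ = no λ ()
  final ≟State initial = no λ ()
  final ≟State final = yes refl
  final ≟State window _ = no λ ()
  window _ ≟State initial = no λ ()
  window _ ≟State final = no λ ()
  window p ≟State window q = Dec.map′ (cong window) (λ { refl → refl }) (≡-dec _≟ˢ_ p q)

  -- In the state window q, q holds the next maxLhs letters of the input, so reading a letter can
  -- check that no left-hand side starts at it.
  data Transition : State → Sym n → State → Set where
    read-H   : ∀ {q} → ¬ LhsPrefix (Hₛ ∷ q) → Transition initial Hₛ (window q)
    read-gen : ∀ {p x q} → p ≡ take maxLhs (gen x ∷ q) → ¬ LhsPrefix (gen x ∷ q) →
               Transition (window p) (gen x) (window q)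
    read-K   : ∀ {p} → p ≡ take maxLhs [ Kₛ ] → ¬ LhsPrefix [ Kₛ ] → Transition (window p) Kₛ final

  transition? : ∀ i a j → Dec (Transition i a j)
  transition? initial Hₛ (window q) =
    Dec.map′ read-H (λ { (read-H ¬p) → ¬p }) (Dec.¬? (lhsPrefix? (Hₛ ∷ q)))
  transition? initial Hₛ initial = no λ ()
  transition? initial Hₛ final = no λ ()
  transition? initial (gen _) _ = no λ ()
  transition? initial Kₛ _ = no λ ()
  transition? (window p) (gen x) (window q) =
    Dec.map′ (λ (e , ¬p) → read-gen e ¬p) (λ { (read-gen e ¬p) → e , ¬p })
             (≡-dec _≟ˢ_ p (take maxLhs (gen x ∷ q)) Dec.×-dec Dec.¬? (lhsPrefix? (gen x ∷ q)))
  transition? (window _) (gen _) initial = no λ ()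
  transition? (window _) (gen _) final = no λ ()
  transition? (window _) Hₛ _ = no λ ()
  transition? (window p) Kₛ final =
    Dec.map′ (λ (e , ¬p) → read-K e ¬p) (λ { (read-K e ¬p) → e , ¬p })
             (≡-dec _≟ˢ_ p (take maxLhs [ Kₛ ]) Dec.×-dec Dec.¬? (lhsPrefix? [ Kₛ ]))
  transition? (window _) Kₛ initial = no λ ()
  transition? (window _) Kₛ (window _) = no λ ()
  transition? final _ _ = no λ ()

  alphabet : List (Sym n)
  alphabet = Hₛ ∷ Kₛ ∷ map gen (allFin n)

  ∈-alphabet : ∀ a → a ∈ alphabet
  ∈-alphabet Hₛ = here refl
  ∈-alphabet Kₛ = there (here refl)
  ∈-alphabet (gen x) = there (there (∈-map⁺ gen (∈-allFin x)))

  wordsUpTo : ℕ → List (Word (Sym n))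
  wordsUpTo zero = [ [] ]
  wordsUpTo (suc k) = [] ∷ cartesianProductWith _∷_ alphabet (wordsUpTo k)

  ∈-wordsUpTo : ∀ {k} z → length z ≤ k → z ∈ wordsUpTo k
  ∈-wordsUpTo {zero} [] _ = here refl
  ∈-wordsUpTo {suc k} [] _ = here refl
  ∈-wordsUpTo {suc k} (a ∷ z) (s≤s |z|≤k) =
    there (∈-cartesianProductWith⁺ _∷_ (∈-alphabet a) (∈-wordsUpTo z |z|≤k))

  windows : List State
  windows = map window (wordsUpTo maxLhs)

  window∈windows : ∀ y → window (take maxLhs y) ∈ windows
  window∈windows y = ∈-map⁺ window
    (∈-wordsUpTo (take maxLhs y) (≤-trans (≤-reflexive (length-take maxLhs y)) (m⊓n≤m maxLhs _)))

  take-∷-take : ∀ k a (y : Word (Sym n)) → take k (a ∷ take k y) ≡ take k (a ∷ y)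
  take-∷-take zero a y = refl
  take-∷-take (suc k) a y =
    cong (a ∷_) (trans (take-take k (suc k) y) (cong (λ m → take m y) (m≤n⇒m⊓n≡m (n≤1+n k))))

  lhsPrefix-window : ∀ a y → LhsPrefix (a ∷ y) ⇔ LhsPrefix (a ∷ take maxLhs y)
  lhsPrefix-window a y = lhsPrefix⇔lhsPrefix-take (n≤1+n maxLhs) (a ∷ y)

  open Kleene _≟State_ alphabet ∈-alphabet Transition transition?

  normalFormRegExp : RegExp (Sym n)
  normalFormRegExp = pathRegExp windows initial final

  remaining-sound : ∀ {p w} → Path windows (window p) w final →
                    ∃ λ v → w ≡ ⌜ v ⌝ ++ [ Kₛ ] × p ≡ take maxLhs w × Irreducible (ListRules RC) w
  remaining-sound (edge (read-K refl ¬p) _ []) =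
    [] , refl , refl , irreducible-∷ ¬p (¬lhsPrefix⇒irreducible-[] ¬p)
  remaining-sound (edge (read-K _ _) _ (edge () _ _))
  remaining-sound (edge (read-gen {x = x} refl ¬p) _ rest) with v , refl , refl , irr ← remaining-sound rest =
    x ∷ v , refl , take-∷-take maxLhs (gen x) _ ,
    irreducible-∷ (¬p ∘ Equivalence.to (lhsPrefix-window (gen x) _)) irr

  normalFormRegExp-sound : ∀ {w} → w ∈L normalFormRegExp →
                           ∃ λ v → w ≡ HwK v × Irreducible (ListRules RC) w
  normalFormRegExp-sound m with pathRegExp-sound windows m
  ... | edge (read-H ¬p) _ rest with v , refl , refl , irr ← remaining-sound rest =
    v , refl , irreducible-∷ (¬p ∘ Equivalence.to (lhsPrefix-window Hₛ _)) irr

  remaining-complete : ∀ v → Irreducible (ListRules RC) (⌜ v ⌝ ++ [ Kₛ ]) →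
                       Path windows (window (take maxLhs (⌜ v ⌝ ++ [ Kₛ ]))) (⌜ v ⌝ ++ [ Kₛ ]) final
  remaining-complete [] irr = edge (read-K refl (irreducible⇒¬lhsPrefix irr)) (inj₂ refl) []
  remaining-complete (x ∷ v) irr =
    edge (read-gen (sym (take-∷-take maxLhs (gen x) _))
                   (irreducible⇒¬lhsPrefix irr ∘ Equivalence.from (lhsPrefix-window (gen x) _)))
         (inj₁ (window∈windows _))
         (remaining-complete v (irreducible-++⁻ʳ [ gen x ] _ irr))

  normalFormRegExp-complete : ∀ v → Irreducible (ListRules RC) (HwK v) → HwK v ∈L normalFormRegExp
  normalFormRegExp-complete v irr = pathRegExp-complete windows
    (edge (read-H (irreducible⇒¬lhsPrefix irr ∘ Equivalence.from (lhsPrefix-window Hₛ _)))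
          (inj₁ (window∈windows _))
          (remaining-complete v (irreducible-++⁻ʳ [ Hₛ ] _ irr)))

module DoubleCosets {n : ℕ} (RG : Rules (Fin n)) (XH XK : Word (Fin n) → Set)
                    (isGroup : Presentation.IsGroup RG) where

  open Presentation RG

  R : Rules (Sym n)
  R = DCRules RG XH XK

  _∼_ : X* → X* → Set
  _∼_ = DoubleCoset XH XK

  module ≈G-Reasoning = SetoidReasoning (EqClosure.setoid (Step RG))
  module R-Reasoning = SetoidReasoning (EqClosure.setoid (Step R))
  module ≡ = ≡-Reasoning

  ≈G-sym : ∀ {x y} → x ≈G y → y ≈G x
  ≈G-sym = EqClosure.symmetric (Step RG)

  rule⇒≈G : ∀ {l r} → RG l r → l ≈G r
  rule⇒≈G {l} {r} lr =
    EqClosure.return (subst₂ (Step RG) (++-identityʳ l) (++-identityʳ r) (step [] l r [] lr))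

  right-inverse⇒left-inverse : ∀ x v → (x ++ v) ≈G [] → (v ++ x) ≈G []
  right-inverse⇒left-inverse x v xv with y , _ , yx ← isGroup x = begin
    v ++ x ≈⟨ cong-context [] x v≈y ⟩
    y ++ x ≈⟨ yx ⟩
    []     ∎
    where
      open ≈G-Reasoning
      v≈y : v ≈G y
      v≈y = begin
        v                   ≈⟨ cong-context [] v yx ⟨
        (y ++ x) ++ v       ≡⟨ solve (++-monoid (Fin n)) ⟩
        y ++ (x ++ v) ++ [] ≈⟨ cong-context y [] xv ⟩
        y ++ []             ≡⟨ ++-identityʳ y ⟩
        y                   ∎

  InSubgroup-++ : ∀ {X p q} → InSubgroup X p → InSubgroup X q → InSubgroup X (p ++ q)
  InSubgroup-++ {X} {p} P sg-ε = subst (InSubgroup X) (sym (++-identityʳ p)) P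
  InSubgroup-++ {X} {p} P (sg-gen {u} {x} Q xx) =
    subst (InSubgroup X) (++-assoc p u x) (sg-gen (InSubgroup-++ P Q) xx)
  InSubgroup-++ {X} {p} P (sg-inv {u} {x} {v} Q xx xv) =
    subst (InSubgroup X) (++-assoc p u v) (sg-inv (InSubgroup-++ P Q) xx xv)

  ∼-refl : ∀ g → g ∼ g
  ∼-refl g = [] , [] , sg-ε , sg-ε , subst ((g ++ []) ≈G_) (++-identityʳ g) ε

  ∼-respˡ-≈G : ∀ {b b′ g} → b ≈G b′ → b ∼ g → b′ ∼ g
  ∼-respˡ-≈G b≈b′ (h , k , sh , sk , c) = h , k , sh , sk , ≈G-sym (cong-context h k b≈b′) ◅◅ c

  ∼-dropˡ : ∀ {h b g} → XH h → (h ++ b) ∼ g → b ∼ g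
  ∼-dropˡ {h} {b} {g} xh (h₀ , k , sh , sk , c) =
    h₀ ++ h , k , sg-gen sh xh , sk , subst (_≈G g) reassociate c
    where
      reassociate : h₀ ++ (h ++ b) ++ k ≡ (h₀ ++ h) ++ b ++ k
      reassociate = solve (++-monoid (Fin n))

  ∼-addˡ : ∀ {h b g} → XH h → b ∼ g → (h ++ b) ∼ g
  ∼-addˡ {h} {b} {g} xh (h₀ , k , sh , sk , c) with v , hv , vh ← isGroup h =
    h₀ ++ v , k , sg-inv sh xh hv , sk , (begin
      (h₀ ++ v) ++ (h ++ b) ++ k ≡⟨ solve (++-monoid (Fin n)) ⟩
      h₀ ++ (v ++ h) ++ b ++ k   ≈⟨ cong-context h₀ (b ++ k) vh ⟩
      h₀ ++ b ++ k               ≈⟨ c ⟩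
      g                          ∎)
    where open ≈G-Reasoning

  ∼-dropʳ : ∀ {k b g} → XK k → (b ++ k) ∼ g → b ∼ g
  ∼-dropʳ {k} {b} {g} xk (h , k₀ , sh , sk , c) =
    h , k ++ k₀ , sh , InSubgroup-++ (sg-gen sg-ε xk) sk , subst (_≈G g) reassociate c
    where
      reassociate : h ++ (b ++ k) ++ k₀ ≡ h ++ b ++ k ++ k₀
      reassociate = solve (++-monoid (Fin n))

  ∼-addʳ : ∀ {k b g} → XK k → b ∼ g → (b ++ k) ∼ g
  ∼-addʳ {k} {b} {g} xk (h , k₀ , sh , sk , c) with v , kv , _ ← isGroup k =
    h , v ++ k₀ , sh , InSubgroup-++ (sg-inv sg-ε xk kv) sk , (begin
      h ++ (b ++ k) ++ v ++ k₀    ≡⟨ solve (++-monoid (Fin n)) ⟩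
      (h ++ b) ++ (k ++ v) ++ k₀  ≈⟨ cong-context (h ++ b) k₀ kv ⟩
      (h ++ b) ++ k₀              ≡⟨ ++-assoc h b k₀ ⟩
      h ++ b ++ k₀                ≈⟨ c ⟩
      g                           ∎)
    where open ≈G-Reasoning

  lift-step : ∀ {x y} → Step RG x y → Step R ⌜ x ⌝ ⌜ y ⌝
  lift-step (step u l r v lr) =
    subst₂ (Step R) (sym (⌜⌝-++₃ u l v)) (sym (⌜⌝-++₃ u r v))
      (step ⌜ u ⌝ ⌜ l ⌝ ⌜ r ⌝ ⌜ v ⌝ (inj₁ (l , r , lr , refl , refl)))

  lift-≈G : ∀ {x y} → x ≈G y → Cong R ⌜ x ⌝ ⌜ y ⌝
  lift-≈G = EqClosure.gmap ⌜_⌝ lift-step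

  H-step : ∀ {h} → XH h → ∀ t → Step R (Hₛ ∷ ⌜ h ⌝ ++ t) (Hₛ ∷ t)
  H-step {h} xh t = step [] (Hₛ ∷ ⌜ h ⌝) [ Hₛ ] t (inj₂ (inj₁ (h , xh , refl , refl)))

  K-step : ∀ {k} → XK k → ∀ t → Step R (t ++ ⌜ k ⌝ ++ [ Kₛ ]) (t ++ [ Kₛ ])
  K-step {k} xk t = subst (λ z → Step R (t ++ z) (t ++ [ Kₛ ])) (++-identityʳ _)
    (step t (⌜ k ⌝ ++ [ Kₛ ]) [ Kₛ ] [] (inj₂ (inj₂ (k , xk , refl , refl))))

  H-absorbs : ∀ {h} → InSubgroup XH h → ∀ t → Cong R (Hₛ ∷ ⌜ h ⌝ ++ t) (Hₛ ∷ t)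
  H-absorbs sg-ε t = ε
  H-absorbs (sg-gen {u} {x} su xx) t = begin
    Hₛ ∷ ⌜ u ++ x ⌝ ++ t     ≡⟨ cong (Hₛ ∷_) (⌜⌝-++-assoc u x t) ⟩
    Hₛ ∷ ⌜ u ⌝ ++ ⌜ x ⌝ ++ t ≈⟨ H-absorbs su (⌜ x ⌝ ++ t) ⟩
    Hₛ ∷ ⌜ x ⌝ ++ t          ≈⟨ EqClosure.return (H-step xx t) ⟩
    Hₛ ∷ t                   ∎
    where open R-Reasoning
  H-absorbs (sg-inv {u} {x} {v} su xx xv) t = begin
    Hₛ ∷ ⌜ u ++ v ⌝ ++ t         ≡⟨ cong (Hₛ ∷_) (⌜⌝-++-assoc u v t) ⟩
    Hₛ ∷ ⌜ u ⌝ ++ ⌜ v ⌝ ++ t     ≈⟨ H-absorbs su (⌜ v ⌝ ++ t) ⟩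
    Hₛ ∷ ⌜ v ⌝ ++ t              ≈⟨ EqClosure.return (H-step xx (⌜ v ⌝ ++ t)) ⟨
    Hₛ ∷ ⌜ x ⌝ ++ ⌜ v ⌝ ++ t     ≡⟨ cong (Hₛ ∷_) (⌜⌝-++-assoc x v t) ⟨
    Hₛ ∷ ⌜ x ++ v ⌝ ++ t         ≈⟨ cong-context [ Hₛ ] t (lift-≈G xv) ⟩
    Hₛ ∷ t                       ∎
    where open R-Reasoning

  K-absorbs : ∀ {k} → InSubgroup XK k → ∀ t → Cong R (t ++ ⌜ k ⌝ ++ [ Kₛ ]) (t ++ [ Kₛ ])
  K-absorbs sg-ε t = ε
  K-absorbs (sg-gen {u} {x} su xx) t = begin
    t ++ ⌜ u ++ x ⌝ ++ [ Kₛ ]         ≡⟨ reassociate ⟩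
    (t ++ ⌜ u ⌝) ++ ⌜ x ⌝ ++ [ Kₛ ]   ≈⟨ EqClosure.return (K-step xx (t ++ ⌜ u ⌝)) ⟩
    (t ++ ⌜ u ⌝) ++ [ Kₛ ]            ≡⟨ ++-assoc t ⌜ u ⌝ [ Kₛ ] ⟩
    t ++ ⌜ u ⌝ ++ [ Kₛ ]              ≈⟨ K-absorbs su t ⟩
    t ++ [ Kₛ ]                       ∎
    where
      open R-Reasoning
      reassociate : t ++ ⌜ u ++ x ⌝ ++ [ Kₛ ] ≡ (t ++ ⌜ u ⌝) ++ ⌜ x ⌝ ++ [ Kₛ ]
      reassociate = trans (cong (t ++_) (⌜⌝-++-assoc u x [ Kₛ ])) (solve (++-monoid (Sym n)))
  -- sg-inv only records x v = 1, while absorbing v next to K needs v x = 1.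
  K-absorbs (sg-inv {u} {x} {v} su xx xv) t = begin
    t ++ ⌜ u ++ v ⌝ ++ [ Kₛ ]                  ≡⟨ reassociate₁ ⟩
    (t ++ ⌜ u ⌝ ++ ⌜ v ⌝) ++ [ Kₛ ]            ≈⟨ EqClosure.return (K-step xx (t ++ ⌜ u ⌝ ++ ⌜ v ⌝)) ⟨
    (t ++ ⌜ u ⌝ ++ ⌜ v ⌝) ++ ⌜ x ⌝ ++ [ Kₛ ]   ≡⟨ reassociate₂ ⟩
    (t ++ ⌜ u ⌝) ++ ⌜ v ++ x ⌝ ++ [ Kₛ ]
      ≈⟨ cong-context (t ++ ⌜ u ⌝) [ Kₛ ] (lift-≈G (right-inverse⇒left-inverse x v xv)) ⟩
    (t ++ ⌜ u ⌝) ++ [ Kₛ ]                     ≡⟨ ++-assoc t ⌜ u ⌝ [ Kₛ ] ⟩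
    t ++ ⌜ u ⌝ ++ [ Kₛ ]                       ≈⟨ K-absorbs su t ⟩
    t ++ [ Kₛ ]                                ∎
    where
      open R-Reasoning
      reassociate₁ : t ++ ⌜ u ++ v ⌝ ++ [ Kₛ ] ≡ (t ++ ⌜ u ⌝ ++ ⌜ v ⌝) ++ [ Kₛ ]
      reassociate₁ = trans (cong (t ++_) (⌜⌝-++-assoc u v [ Kₛ ])) (solve (++-monoid (Sym n)))
      reassociate₂ : (t ++ ⌜ u ⌝ ++ ⌜ v ⌝) ++ ⌜ x ⌝ ++ [ Kₛ ] ≡ (t ++ ⌜ u ⌝) ++ ⌜ v ++ x ⌝ ++ [ Kₛ ]
      reassociate₂ = ≡.begin
        (t ++ ⌜ u ⌝ ++ ⌜ v ⌝) ++ ⌜ x ⌝ ++ [ Kₛ ] ≡.≡⟨ solve (++-monoid (Sym n)) ⟩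
        (t ++ ⌜ u ⌝) ++ ⌜ v ⌝ ++ ⌜ x ⌝ ++ [ Kₛ ] ≡.≡⟨ cong ((t ++ ⌜ u ⌝) ++_) (⌜⌝-++-assoc v x [ Kₛ ]) ⟨
        (t ++ ⌜ u ⌝) ++ ⌜ v ++ x ⌝ ++ [ Kₛ ]     ≡.∎

  doubleCoset⇒cong : ∀ {w w′} → w ∼ w′ → Cong R (HwK w) (HwK w′)
  doubleCoset⇒cong {w} {w′} (h , k , sh , sk , c) = begin
    Hₛ ∷ ⌜ w ⌝ ++ [ Kₛ ]                       ≈⟨ H-absorbs sh (⌜ w ⌝ ++ [ Kₛ ]) ⟨
    Hₛ ∷ ⌜ h ⌝ ++ ⌜ w ⌝ ++ [ Kₛ ]              ≡⟨ cong (Hₛ ∷_) (++-assoc ⌜ h ⌝ ⌜ w ⌝ [ Kₛ ]) ⟨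
    (Hₛ ∷ ⌜ h ⌝ ++ ⌜ w ⌝) ++ [ Kₛ ]            ≈⟨ K-absorbs sk (Hₛ ∷ ⌜ h ⌝ ++ ⌜ w ⌝) ⟨
    (Hₛ ∷ ⌜ h ⌝ ++ ⌜ w ⌝) ++ ⌜ k ⌝ ++ [ Kₛ ]   ≡⟨ reassociate ⟩
    [ Hₛ ] ++ ⌜ h ++ w ++ k ⌝ ++ [ Kₛ ]        ≈⟨ cong-context [ Hₛ ] [ Kₛ ] (lift-≈G c) ⟩
    Hₛ ∷ ⌜ w′ ⌝ ++ [ Kₛ ]                      ∎
    where
      open R-Reasoning
      reassociate : (Hₛ ∷ ⌜ h ⌝ ++ ⌜ w ⌝) ++ ⌜ k ⌝ ++ [ Kₛ ] ≡ [ Hₛ ] ++ ⌜ h ++ w ++ k ⌝ ++ [ Kₛ ]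
      reassociate = cong (Hₛ ∷_) (≡.begin
        (⌜ h ⌝ ++ ⌜ w ⌝) ++ ⌜ k ⌝ ++ [ Kₛ ] ≡.≡⟨ solve (++-monoid (Sym n)) ⟩
        (⌜ h ⌝ ++ ⌜ w ⌝ ++ ⌜ k ⌝) ++ [ Kₛ ] ≡.≡⟨ cong (_++ [ Kₛ ]) (⌜⌝-++₃ h w k) ⟨
        ⌜ h ++ w ++ k ⌝ ++ [ Kₛ ]          ≡.∎)

  data Shaped (g : X*) (x : Word (Sym n)) : Set where
    shaped : ∀ a b c → x ≡ ⌜ a ⌝ ++ Hₛ ∷ ⌜ b ⌝ ++ Kₛ ∷ ⌜ c ⌝ → a ≈G [] → c ≈G [] → b ∼ g → Shaped g x

  -- A rule of R, used in either direction, as it acts on a word of the shape a H b K c.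
  data Move (g : X*) : Word (Sym n) → Word (Sym n) → Set where
    inside : ∀ {l r} → l ≈G r → Move g ⌜ l ⌝ ⌜ r ⌝
    at-H   : ∀ {p q} → (∀ {b} → (p ++ b) ∼ g → (q ++ b) ∼ g) → Move g (Hₛ ∷ ⌜ p ⌝) (Hₛ ∷ ⌜ q ⌝)
    at-K   : ∀ {p q} → (∀ {b} → (b ++ p) ∼ g → (b ++ q) ∼ g) → Move g (⌜ p ⌝ ++ [ Kₛ ]) (⌜ q ⌝ ++ [ Kₛ ])

  rule⇒move : ∀ {g l r} → R l r → Move g l r
  rule⇒move (inj₁ (l , r , lr , refl , refl)) = inside (rule⇒≈G lr)
  rule⇒move (inj₂ (inj₁ (h , xh , refl , refl))) = at-H {p = h} {q = []} (∼-dropˡ xh)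
  rule⇒move {g} (inj₂ (inj₂ (k , xk , refl , refl))) =
    at-K {p = k} {q = []} λ {b} → subst (_∼ g) (sym (++-identityʳ b)) ∘ ∼-dropʳ xk

  rule⇒move⁻ : ∀ {g l r} → R l r → Move g r l
  rule⇒move⁻ (inj₁ (l , r , lr , refl , refl)) = inside (≈G-sym (rule⇒≈G lr))
  rule⇒move⁻ (inj₂ (inj₁ (h , xh , refl , refl))) = at-H {p = []} {q = h} (∼-addˡ xh)
  rule⇒move⁻ {g} (inj₂ (inj₂ (k , xk , refl , refl))) =
    at-K {p = []} {q = k} λ {b} → ∼-addʳ xk ∘ subst (_∼ g) (++-identityʳ b)

  shaped-inside : ∀ {g l r} u v → l ≈G r → Shaped g (u ++ ⌜ l ⌝ ++ v) → Shaped g (u ++ ⌜ r ⌝ ++ v)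
  shaped-inside {l = l} {r} u v l≈r (shaped a b c e a≈ε c≈ε b∼g) with factor-split ⌜ l ⌝ u (H∉⌜⌝ l) e
  ... | inj₁ (q , e₁ , refl) with a₁ , a₂ , refl , refl , refl ← ⌜⌝-factor a l {u} {q} e₁ =
    shaped (a₁ ++ r ++ a₂) b c (sym (⌜⌝-++₃-++ a₁ r a₂ _)) (cong-context a₁ a₂ (≈G-sym l≈r) ◅◅ a≈ε) c≈ε b∼g
  ... | inj₂ (q , refl , e₂) with factor-split ⌜ l ⌝ q (K∉⌜⌝ l) (sym e₂)
  ...   | inj₁ (q′ , e₃ , refl) with b₁ , b₂ , refl , refl , refl ← ⌜⌝-factor b l {q} {q′} e₃ =
    shaped a (b₁ ++ r ++ b₂) c
      (trans (++-assoc ⌜ a ⌝ _ _) (cong (λ z → ⌜ a ⌝ ++ Hₛ ∷ z) (sym (⌜⌝-++₃-++ b₁ r b₂ _))))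
      a≈ε c≈ε (∼-respˡ-≈G (cong-context b₁ b₂ l≈r) b∼g)
  ...   | inj₂ (q′ , refl , e₄) with c₁ , c₂ , refl , refl , refl ← ⌜⌝-factor c l {q′} {v} e₄ =
    shaped a b (c₁ ++ r ++ c₂) reassociate a≈ε (cong-context c₁ c₂ (≈G-sym l≈r) ◅◅ c≈ε) b∼g
    where
      reassociate : (⌜ a ⌝ ++ Hₛ ∷ ⌜ b ⌝ ++ Kₛ ∷ ⌜ c₁ ⌝) ++ ⌜ r ⌝ ++ ⌜ c₂ ⌝
                    ≡ ⌜ a ⌝ ++ Hₛ ∷ ⌜ b ⌝ ++ Kₛ ∷ ⌜ c₁ ++ r ++ c₂ ⌝
      reassociate = begin
        (⌜ a ⌝ ++ Hₛ ∷ ⌜ b ⌝ ++ Kₛ ∷ ⌜ c₁ ⌝) ++ ⌜ r ⌝ ++ ⌜ c₂ ⌝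
          ≡⟨ ++-assoc ⌜ a ⌝ _ _ ⟩
        ⌜ a ⌝ ++ Hₛ ∷ (⌜ b ⌝ ++ Kₛ ∷ ⌜ c₁ ⌝) ++ ⌜ r ⌝ ++ ⌜ c₂ ⌝
          ≡⟨ cong (λ z → ⌜ a ⌝ ++ Hₛ ∷ z) (++-assoc ⌜ b ⌝ _ _) ⟩
        ⌜ a ⌝ ++ Hₛ ∷ ⌜ b ⌝ ++ Kₛ ∷ ⌜ c₁ ⌝ ++ ⌜ r ⌝ ++ ⌜ c₂ ⌝
          ≡⟨ cong (λ z → ⌜ a ⌝ ++ Hₛ ∷ ⌜ b ⌝ ++ Kₛ ∷ z) (⌜⌝-++₃ c₁ r c₂) ⟨
        ⌜ a ⌝ ++ Hₛ ∷ ⌜ b ⌝ ++ Kₛ ∷ ⌜ c₁ ++ r ++ c₂ ⌝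
          ∎
        where open ≡-Reasoning

  shaped-at-H : ∀ {g p q} u v → (∀ {b} → (p ++ b) ∼ g → (q ++ b) ∼ g) →
                Shaped g (u ++ Hₛ ∷ ⌜ p ⌝ ++ v) → Shaped g (u ++ Hₛ ∷ ⌜ q ⌝ ++ v)
  shaped-at-H {p = p} {q} u v move (shaped a b c e a≈ε c≈ε b∼g)
    with refl , e₁ ← ∷-split-unique u ⌜ a ⌝ (H∉⌜⌝ a) (H∉⌜⌝K⌜⌝ b c) e
    with b″ , e₂ , refl ← prefix-split ⌜ p ⌝ (K∉⌜⌝ p) e₁
    with b′ , refl , refl ← ⌜⌝-prefix b {p} {b″} e₂ =
    shaped a (q ++ b′) c (cong (λ z → ⌜ a ⌝ ++ Hₛ ∷ z) (sym (⌜⌝-++-assoc q b′ _))) a≈ε c≈ε (move b∼g)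

  regroup-at-K : ∀ {x y z t w c : Word (Sym n)} → x ++ (y ++ [ Kₛ ]) ++ z ≡ t ++ Hₛ ∷ w ++ Kₛ ∷ c →
                 (x ++ y) ++ Kₛ ∷ z ≡ (t ++ Hₛ ∷ w) ++ Kₛ ∷ c
  regroup-at-K {x} {y} {z} {t} {w} {c} eq = begin
    (x ++ y) ++ Kₛ ∷ z      ≡⟨ ++-assoc x y _ ⟩
    x ++ y ++ Kₛ ∷ z        ≡⟨ cong (x ++_) (++-assoc y [ Kₛ ] z) ⟨
    x ++ (y ++ [ Kₛ ]) ++ z ≡⟨ eq ⟩
    t ++ Hₛ ∷ w ++ Kₛ ∷ c   ≡⟨ ++-assoc t (Hₛ ∷ w) _ ⟨
    (t ++ Hₛ ∷ w) ++ Kₛ ∷ c ∎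
    where open ≡-Reasoning

  shaped-at-K : ∀ {g p q} u v → (∀ {b} → (b ++ p) ∼ g → (b ++ q) ∼ g) →
                Shaped g (u ++ (⌜ p ⌝ ++ [ Kₛ ]) ++ v) → Shaped g (u ++ (⌜ q ⌝ ++ [ Kₛ ]) ++ v)
  shaped-at-K {p = p} {q} u v move (shaped a b c e a≈ε c≈ε b∼g)
    with e₁ , refl ← ∷-split-unique (u ++ ⌜ p ⌝) (⌜ a ⌝ ++ Hₛ ∷ ⌜ b ⌝) {v} {⌜ c ⌝} (K∉⌜⌝H⌜⌝ a b) (K∉⌜⌝ c)
                                     (regroup-at-K {u} {⌜ p ⌝} {v} e)
    with b″ , refl , e₂ ← suffix-split ⌜ p ⌝ u (H∉⌜⌝ p) e₁
    with b′ , refl , refl ← ⌜⌝-suffix b {p} {b″} e₂ =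
    shaped a (b′ ++ q) c reassociate a≈ε c≈ε (move b∼g)
    where
      reassociate : (⌜ a ⌝ ++ Hₛ ∷ ⌜ b′ ⌝) ++ (⌜ q ⌝ ++ [ Kₛ ]) ++ ⌜ c ⌝
                    ≡ ⌜ a ⌝ ++ Hₛ ∷ ⌜ b′ ++ q ⌝ ++ Kₛ ∷ ⌜ c ⌝
      reassociate = begin
        (⌜ a ⌝ ++ Hₛ ∷ ⌜ b′ ⌝) ++ (⌜ q ⌝ ++ [ Kₛ ]) ++ ⌜ c ⌝
          ≡⟨ ++-assoc ⌜ a ⌝ _ _ ⟩
        ⌜ a ⌝ ++ Hₛ ∷ ⌜ b′ ⌝ ++ (⌜ q ⌝ ++ [ Kₛ ]) ++ ⌜ c ⌝
          ≡⟨ cong (λ z → ⌜ a ⌝ ++ Hₛ ∷ ⌜ b′ ⌝ ++ z) (++-assoc ⌜ q ⌝ _ _) ⟩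
        ⌜ a ⌝ ++ Hₛ ∷ ⌜ b′ ⌝ ++ ⌜ q ⌝ ++ Kₛ ∷ ⌜ c ⌝
          ≡⟨ cong (λ z → ⌜ a ⌝ ++ Hₛ ∷ z) (⌜⌝-++-assoc b′ q _) ⟨
        ⌜ a ⌝ ++ Hₛ ∷ ⌜ b′ ++ q ⌝ ++ Kₛ ∷ ⌜ c ⌝
          ∎
        where open ≡-Reasoning

  shaped-move : ∀ {g l r} u v → Move g l r → Shaped g (u ++ l ++ v) → Shaped g (u ++ r ++ v)
  shaped-move u v (inside l≈r) = shaped-inside u v l≈r
  shaped-move u v (at-H move) = shaped-at-H u v move
  shaped-move u v (at-K move) = shaped-at-K u v move

  shaped-cong : ∀ {g x y} → Cong R x y → Shaped g x → Shaped g y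
  shaped-cong ε s = s
  shaped-cong (fwd (step u l r v lr) ◅ c) s = shaped-cong c (shaped-move u v (rule⇒move lr) s)
  shaped-cong (bwd (step u l r v lr) ◅ c) s = shaped-cong c (shaped-move u v (rule⇒move⁻ lr) s)

  HwK-shaped : ∀ g → Shaped g (HwK g)
  HwK-shaped g = shaped [] g [] refl ε ε (∼-refl g)

mainTheorem5 : (n : ℕ) (RG : Rules (Fin n)) (XH XK : Word (Fin n) → Set)
  → Presentation.IsGroup RG
  → (RC : List (Word (Sym n) × Word (Sym n)))
  → Complete (ListRules RC)
  → (∀ u v → (Cong (ListRules RC) u v → Cong (DCRules RG XH XK) u v)
           × (Cong (DCRules RG XH XK) u v → Cong (ListRules RC) u v))
  → ∃ λ (e : RegExp (Sym n)) →
      (∀ u → u ∈L e → ∃ λ w → u ≡ HwK w)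
    × (∀ w w' → HwK w ∈L e → HwK w' ∈L e
         → Presentation.DoubleCoset RG XH XK w w' → w ≡ w')
    × (∀ g → ∃ λ w → HwK w ∈L e × Presentation.DoubleCoset RG XH XK w g)
mainTheorem5 n RG XH XK isGroup RC (terminating , confluent) sameCongruence =
  normalFormRegExp , words-are-HwK , distinct-cosets , every-coset
  where
    open NormalFormAutomaton RC
    open ListRewriting _≟ˢ_ RC using (normalForm)
    open DoubleCosets RG XH XK isGroup
    open Presentation RG using (_≈G_)

    words-are-HwK : ∀ u → u ∈L normalFormRegExp → ∃ λ w → u ≡ HwK w
    words-are-HwK u m with w , u≡HwK , _ ← normalFormRegExp-sound m = w , u≡HwK

    unique-normal-form : ∀ {x y} → Irreducible (ListRules RC) x → Irreducible (ListRules RC) y →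
                         Cong R x y → x ≡ y
    unique-normal-form irrx irry = irreducible-cong⇒≡ confluent irrx irry ∘ proj₂ (sameCongruence _ _)

    distinct-cosets : ∀ w w′ → HwK w ∈L normalFormRegExp → HwK w′ ∈L normalFormRegExp →
                      w ∼ w′ → w ≡ w′
    distinct-cosets w w′ m m′ w∼w′ =
      HwK-injective (unique-normal-form (proj₂ (proj₂ (normalFormRegExp-sound m)))
                                        (proj₂ (proj₂ (normalFormRegExp-sound m′))) (doubleCoset⇒cong w∼w′))

    trivial-irreducible : ∀ {a} → Irreducible (ListRules RC) ⌜ a ⌝ → a ≈G [] → a ≡ []
    trivial-irreducible irr a≈ε =
      ⌜⌝-injective (unique-normal-form irr (terminating⇒irreducible-[] terminating) (lift-≈G a≈ε))

    every-coset : ∀ g → ∃ λ w → HwK w ∈L normalFormRegExp × w ∼ g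
    every-coset g with v , HwK⟶v , irr ← normalForm terminating (HwK g)
      with shaped a b c refl a≈ε c≈ε b∼g ←
             shaped-cong (proj₁ (sameCongruence _ _) (reduction⇒cong HwK⟶v)) (HwK-shaped g)
      with refl ← trivial-irreducible (irreducible-++⁻ˡ ⌜ a ⌝ _ irr) a≈ε
      with refl ← trivial-irreducible
                    (irreducible-++⁻ʳ (HwK b) ⌜ c ⌝ (subst (Irreducible (ListRules RC)) (HwK-++ b ⌜ c ⌝) irr)) c≈ε =
      b , normalFormRegExp-complete b irr , b∼g
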